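{- For any tree $T$ with $n\geq 3$ vertices, there exists a minimum independent ve-dominating set of $T$ (an $i_{ve}$-set) which contains no leaf of $T$.
   Context: A vertex $u$ ve-dominates an edge $e$ if $e$ is incident to some vertex of the closed neighbourhood $N[u]$; $S\subseteq V$ is a ve-dominating set if every edge is ve-dominated by some vertex of $S$. An independent ve-dominating set is a ve-dominating set that is an independent set; an $i_{ve}$-set is one of minimum cardinality $i_{ve}(T)$. -}

module Defs where

open import Data.Nat using (ℕ; _≤_)
open import Data.Fin using (Fin)
open import Data.Fin.Subset using (Subset; _∈_; ∣_∣)
open import Data.List using (List; []; _∷_; _++_; [_]; length)
open import Data.List.Relation.Unary.Linked using (Linked)
open import Data.List.Relation.Unary.Unique.Propositional using (Unique)
open import Data.Product using (Σ; ∃; _×_; _,_)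
open import Data.Sum using (_⊎_)
open import Data.Empty using (⊥)
open import Relation.Nullary using (¬_; Dec)
open import Relation.Binary.PropositionalEquality using (_≡_)

record Graph (n : ℕ) : Set₁ where
  field
    Adj     : Fin n → Fin n → Set
    sym     : ∀ {u v} → Adj u v → Adj v u
    irrefl  : ∀ {u} → ¬ Adj u u
    adj?    : ∀ u v → Dec (Adj u v)

module _ {n : ℕ} (G : Graph n) where
  open Graph G

  data Walk : Fin n → Fin n → Set where
    here  : ∀ {u} → Walk u u
    step  : ∀ {u w v} → Adj u w → Walk w v → Walk u v

  Connected : Set
  Connected = ∀ u v → Walk u v

  -- a cycle v ∷ ys: at least 3 distinct vertices, consecutive ones adjacent,
  -- last adjacent to v
  IsCycle : Fin n → List (Fin n) → Set
  IsCycle v ys = 2 ≤ length ys × Unique (v ∷ ys) × Linked Adj (v ∷ ys ++ [ v ])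

  Acyclic : Set
  Acyclic = ∀ v ys → ¬ IsCycle v ys

  IsTree : Set
  IsTree = Connected × Acyclic

  IsLeaf : Fin n → Set
  IsLeaf v = ∃ λ u → Adj v u × (∀ w → Adj v w → w ≡ u)

  InClosedNbhd : Fin n → Fin n → Set
  InClosedNbhd u x = x ≡ u ⊎ Adj u x

  VeDominatesEdge : Fin n → Fin n → Fin n → Set
  VeDominatesEdge u x y = InClosedNbhd u x ⊎ InClosedNbhd u y

  IsVeDominating : Subset n → Set
  IsVeDominating S = ∀ x y → Adj x y → ∃ λ u → u ∈ S × VeDominatesEdge u x y

  IsIndependent : Subset n → Set
  IsIndependent S = ∀ u v → u ∈ S → v ∈ S → ¬ Adj u v

  IsIndepVeDominating : Subset n → Set
  IsIndepVeDominating S = IsIndependent S × IsVeDominating S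

  IsIveSet : Subset n → Set
  IsIveSet S = IsIndepVeDominating S × (∀ S′ → IsIndepVeDominating S′ → ∣ S ∣ ≤ ∣ S′ ∣)

module Submission where

-- Among the i_ve-sets choose one, S, with the fewest leaves. If a leaf v were in S, its
-- neighbour u is not a leaf (n ≥ 3 and T is connected). Every edge ve-dominated by v is
-- incident to u, hence ve-dominated by any vertex of N[u]. So if u has a neighbour in
-- S - v, dropping v leaves an independent ve-dominating set; otherwise replacing v by u
-- does. Either way the new set is no larger, hence again an i_ve-set, with fewer leaves.

open import Level using (Level)
open import Defs
open import Data.Bool using (true)
open import Data.Bool.Properties using (T-≡)
open import Data.Nat using (ℕ; suc; _+_; _∸_; _≤_; _<_; _≤?_; _<?_; z≤n; s≤s)
open import Data.Nat.Properties
  using (≤-refl; ≤-reflexive; ≤-trans; <⇒≤; <⇒≱; ≤⇒≯; ≮⇒≥; <-≤-trans; n≤1+n; +-suc; +-monoʳ-≤; ∸-monoʳ-<; module ≤-Reasoning)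
open import Data.Fin using (Fin; zero; suc; _≟_)
open import Data.Fin.Properties using (any?; all?)
open import Data.Fin.Subset using (Subset; inside; outside; _∈_; _∉_; _⊆_; _⊂_; ∣_∣; ⁅_⁆; _∪_; _∩_; _─_; _-_)
  renaming (⊥ to ∅)
open import Data.Fin.Subset.Properties
  using (_∈?_; anySubset?; ∉⊥; ∣p∣≤n; ∣⁅x⁆∣≡1; x∈⁅x⁆; x∈⁅y⁆⇒x≡y; q⊆p∪q; x∈p∪q⁺; x∈p∪q⁻;
         x∈p∩q⁺; x∈p∩q⁻; p─q⊆p; x∈p∧x≢y⇒x∈p-y; x∈p⇒∣p-x∣<∣p∣; p⊂q⇒∣p∣<∣q∣)
open import Data.Vec using ([]; _∷_; tabulate; here; there)
open import Data.Vec.Properties using (lookup∘tabulate; []=⇒lookup; lookup⇒[]=)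
open import Data.Product using (∃; _×_; _,_; proj₁)
open import Data.Sum using (_⊎_; inj₁; inj₂)
open import Data.Empty using (⊥-elim)
open import Function.Bundles using (Equivalence)
open import Relation.Unary using (Pred; Decidable)
open import Relation.Nullary using (¬_; Dec; yes; no; does; contradiction)
open import Relation.Nullary.Decidable using (_×-dec_; _⊎-dec_; _→-dec_; ¬?; decidable-stable; dec-true; isYes≗does; toWitness)
open import Relation.Binary.PropositionalEquality using (_≡_; _≢_; refl; sym; trans; cong)

private
  variable
    ℓ : Level
    n : ℕ

∣p∪q∣≤∣p∣+∣q∣ : (p q : Subset n) → ∣ p ∪ q ∣ ≤ ∣ p ∣ + ∣ q ∣
∣p∪q∣≤∣p∣+∣q∣ []            []            = z≤n
∣p∪q∣≤∣p∣+∣q∣ (outside ∷ p) (outside ∷ q) = ∣p∪q∣≤∣p∣+∣q∣ p q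
∣p∪q∣≤∣p∣+∣q∣ (outside ∷ p) (inside ∷ q)  =
  ≤-trans (s≤s (∣p∪q∣≤∣p∣+∣q∣ p q)) (≤-reflexive (sym (+-suc ∣ p ∣ ∣ q ∣)))
∣p∪q∣≤∣p∣+∣q∣ (inside ∷ p)  (outside ∷ q) = s≤s (∣p∪q∣≤∣p∣+∣q∣ p q)
∣p∪q∣≤∣p∣+∣q∣ (inside ∷ p)  (inside ∷ q)  =
  s≤s (≤-trans (∣p∪q∣≤∣p∣+∣q∣ p q) (+-monoʳ-≤ ∣ p ∣ (n≤1+n ∣ q ∣)))

x∈q⇒x∉p─q : (p q : Subset n) {x : Fin n} → x ∈ q → x ∉ p ─ q
x∈q⇒x∉p─q (_ ∷ p) (inside ∷ q) here        ()
x∈q⇒x∉p─q (_ ∷ p) (_ ∷ q)      (there x∈q) (there x∈p─q) = x∈q⇒x∉p─q p q x∈q x∈p─q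

x∉p-x : (p : Subset n) (x : Fin n) → x ∉ p - x
x∉p-x p x = x∈q⇒x∉p─q p ⁅ x ⁆ (x∈⁅x⁆ x)

x∈⁅y⁆∪p⁻ : {p : Subset n} (y : Fin n) {x : Fin n} → x ∈ ⁅ y ⁆ ∪ p → x ≡ y ⊎ x ∈ p
x∈⁅y⁆∪p⁻ {p = p} y x∈ with x∈p∪q⁻ ⁅ y ⁆ p x∈
... | inj₁ x∈⁅y⁆ = inj₁ (x∈⁅y⁆⇒x≡y y x∈⁅y⁆)
... | inj₂ x∈p   = inj₂ x∈p

x∉p⇒p⊂⁅x⁆∪p : {p : Subset n} {x : Fin n} → x ∉ p → p ⊂ ⁅ x ⁆ ∪ p
x∉p⇒p⊂⁅x⁆∪p {p = p} {x} x∉p = q⊆p∪q ⁅ x ⁆ p , x , x∈p∪q⁺ (inj₁ (x∈⁅x⁆ x)) , x∉p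

y∈p⇒∣⁅x⁆∪p-y∣≤∣p∣ : {p : Subset n} (x : Fin n) {y : Fin n} → y ∈ p → ∣ ⁅ x ⁆ ∪ (p - y) ∣ ≤ ∣ p ∣
y∈p⇒∣⁅x⁆∪p-y∣≤∣p∣ {p = p} x {y} y∈p = begin
  ∣ ⁅ x ⁆ ∪ (p - y) ∣   ≤⟨ ∣p∪q∣≤∣p∣+∣q∣ ⁅ x ⁆ (p - y) ⟩
  ∣ ⁅ x ⁆ ∣ + ∣ p - y ∣ ≡⟨ cong (_+ ∣ p - y ∣) (∣⁅x⁆∣≡1 x) ⟩
  suc ∣ p - y ∣         ≤⟨ x∈p⇒∣p-x∣<∣p∣ y∈p ⟩
  ∣ p ∣                 ∎
  where open ≤-Reasoning

exchange⇒∩⊂ : {p q r : Subset n} {x y : Fin n} →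
  q ⊆ ⁅ x ⁆ ∪ (p - y) → x ∉ r → y ∈ p → y ∈ r → q ∩ r ⊂ p ∩ r
exchange⇒∩⊂ {p = p} {q} {r} {x} {y} q⊆ x∉r y∈p y∈r =
  shrinks , y , x∈p∩q⁺ (y∈p , y∈r) , y∉q∩r
  where
  from-q : ∀ {z} → z ∈ q → z ≡ x ⊎ z ∈ p - y
  from-q z∈q = x∈⁅y⁆∪p⁻ x (q⊆ z∈q)
  shrinks : q ∩ r ⊆ p ∩ r
  shrinks {z} z∈q∩r with x∈p∩q⁻ q r z∈q∩r
  ... | z∈q , z∈r with from-q z∈q
  ... | inj₁ refl  = contradiction z∈r x∉r
  ... | inj₂ z∈p-y = x∈p∩q⁺ (p─q⊆p p ⁅ y ⁆ z∈p-y , z∈r)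
  y∉q∩r : y ∉ q ∩ r
  y∉q∩r y∈q∩r with from-q (proj₁ (x∈p∩q⁻ q r y∈q∩r))
  ... | inj₁ refl  = x∉r y∈r
  ... | inj₂ y∈p-y = x∉p-x p y y∈p-y

allSubset? : {P : Pred (Subset n) ℓ} → Decidable P → Dec (∀ p → P p)
allSubset? P? with anySubset? (λ p → ¬? (P? p))
... | yes (p , ¬Pp) = no λ ∀P → ¬Pp (∀P p)
... | no ∄¬P        = yes λ p → decidable-stable (P? p) λ ¬Pp → ∄¬P (p , ¬Pp)

module _ {P : Pred (Fin n) ℓ} (P? : Decidable P) where

  satisfying : Subset n
  satisfying = tabulate (λ x → does (P? x))

  ∈-satisfying⁺ : ∀ {x} → P x → x ∈ satisfying
  ∈-satisfying⁺ {x} Px = lookup⇒[]= x satisfying (trans (lookup∘tabulate _ x) (dec-true (P? x) Px))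

  ∈-satisfying⁻ : ∀ {x} → x ∈ satisfying → P x
  ∈-satisfying⁻ {x} x∈ =
    toWitness {a? = P? x} (Equivalence.from T-≡ (trans (isYes≗does (P? x)) does≡true))
    where
    does≡true : does (P? x) ≡ true
    does≡true = trans (sym (lookup∘tabulate _ x)) ([]=⇒lookup x∈)

Minimal : Pred (Subset n) ℓ → (Subset n → ℕ) → Subset n → Set ℓ
Minimal P f p = P p × (∀ q → P q → f p ≤ f q)

module _ {P : Pred (Subset n) ℓ} (P? : Decidable P) (f : Subset n → ℕ) where

  minimal? : Decidable (Minimal P f)
  minimal? p = P? p ×-dec allSubset? (λ q → P? q →-dec (f p ≤? f q))

  private
    descend : ∀ k p → f p < k → P p → ∃ (Minimal P f)
    descend (suc k) p (s≤s fp≤k) Pp with anySubset? (λ q → P? q ×-dec (f q <? f p))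
    ... | yes (q , Pq , fq<fp) = descend k q (<-≤-trans fq<fp fp≤k) Pq
    ... | no ∄smaller          = p , Pp , λ q Pq → ≮⇒≥ λ fq<fp → ∄smaller (q , Pq , fq<fp)

  ∃-minimal : ∃ P → ∃ (Minimal P f)
  ∃-minimal (p , Pp) = descend (suc (f p)) p ≤-refl Pp

Minimal-≤ : {P : Pred (Subset n) ℓ} {f : Subset n → ℕ} {p q : Subset n} →
  Minimal P f p → P q → f q ≤ f p → Minimal P f q
Minimal-≤ (_ , p-min) Pq fq≤fp = Pq , λ r Pr → ≤-trans fq≤fp (p-min r Pr)

∃-avoiding₂ : 3 ≤ n → (u v : Fin n) → ∃ λ w → w ≢ u × w ≢ v
∃-avoiding₂ (s≤s (s≤s (s≤s _))) zero          zero          = suc zero       , (λ ()) , (λ ())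
∃-avoiding₂ (s≤s (s≤s (s≤s _))) zero          (suc zero)    = suc (suc zero) , (λ ()) , (λ ())
∃-avoiding₂ (s≤s (s≤s (s≤s _))) zero          (suc (suc _)) = suc zero       , (λ ()) , (λ ())
∃-avoiding₂ (s≤s (s≤s (s≤s _))) (suc zero)    zero          = suc (suc zero) , (λ ()) , (λ ())
∃-avoiding₂ (s≤s (s≤s (s≤s _))) (suc (suc _)) zero          = suc zero       , (λ ()) , (λ ())
∃-avoiding₂ (s≤s (s≤s (s≤s _))) (suc _)       (suc _)       = zero           , (λ ()) , (λ ())

module _ (G : Graph n) where
  open Graph G renaming (sym to adj-sym)

  SoleNeighbour : Fin n → Fin n → Set
  SoleNeighbour v u = Adj v u × (∀ w → Adj v w → w ≡ u)

  leaf? : Decidable (IsLeaf G)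
  leaf? v = any? λ u → adj? v u ×-dec all? λ w → adj? v w →-dec (w ≟ u)

  leaves : Subset n
  leaves = satisfying leaf?

  independent? : Decidable (IsIndependent G)
  independent? S = all? λ u → all? λ v → (u ∈? S) →-dec ((v ∈? S) →-dec ¬? (adj? u v))

  inClosedNbhd? : ∀ u → Decidable (InClosedNbhd G u)
  inClosedNbhd? u x = (x ≟ u) ⊎-dec adj? u x

  veDominating? : Decidable (IsVeDominating G)
  veDominating? S = all? λ x → all? λ y → adj? x y →-dec
    any? λ u → (u ∈? S) ×-dec (inClosedNbhd? u x ⊎-dec inClosedNbhd? u y)

  indepVeDominating? : Decidable (IsIndepVeDominating G)
  indepVeDominating? S = independent? S ×-dec veDominating? S

  iveSet? : Decidable (IsIveSet G)
  iveSet? = minimal? indepVeDominating? ∣_∣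

  independent-⊆ : {p q : Subset n} → p ⊆ q → IsIndependent G q → IsIndependent G p
  independent-⊆ p⊆q ind a b a∈p b∈p = ind a b (p⊆q a∈p) (p⊆q b∈p)

  independent-insert : {p : Subset n} {x : Fin n} →
    IsIndependent G p → (∀ w → w ∈ p → ¬ Adj x w) → IsIndependent G (⁅ x ⁆ ∪ p)
  independent-insert {x = x} ind x≁p a b a∈ b∈ a~b with x∈⁅y⁆∪p⁻ x a∈ | x∈⁅y⁆∪p⁻ x b∈
  ... | inj₁ refl | inj₁ refl = irrefl a~b
  ... | inj₁ refl | inj₂ b∈p  = x≁p b b∈p a~b
  ... | inj₂ a∈p  | inj₁ refl = x≁p a a∈p (adj-sym a~b)
  ... | inj₂ a∈p  | inj₂ b∈p  = ind a b a∈p b∈p a~b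

  Dominating : Subset n → Set
  Dominating S = ∀ x → x ∈ S ⊎ ∃ λ s → s ∈ S × Adj s x

  dominating⇒veDominating : {S : Subset n} → Dominating S → IsVeDominating G S
  dominating⇒veDominating dom x y _ with dom x
  ... | inj₁ x∈S            = x , x∈S , inj₁ (inj₁ refl)
  ... | inj₂ (s , s∈S , s~x) = s , s∈S , inj₁ (inj₂ s~x)

  maximum-independent⇒dominating : {S : Subset n} →
    Minimal (IsIndependent G) (λ S → n ∸ ∣ S ∣) S → Dominating S
  maximum-independent⇒dominating {S} (ind , max) x
    with x ∈? S | any? (λ s → (s ∈? S) ×-dec adj? s x)
  ... | yes x∈S | _           = inj₁ x∈S
  ... | no _    | yes s~x     = inj₂ s~x
  ... | no x∉S  | no x≁S      = ⊥-elim (≤⇒≯ (max (⁅ x ⁆ ∪ S) ind′) larger)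
    where
    ind′ : IsIndependent G (⁅ x ⁆ ∪ S)
    ind′ = independent-insert ind λ s s∈S x~s → x≁S (s , s∈S , adj-sym x~s)
    larger : n ∸ ∣ ⁅ x ⁆ ∪ S ∣ < n ∸ ∣ S ∣
    larger = ∸-monoʳ-< (p⊂q⇒∣p∣<∣q∣ (x∉p⇒p⊂⁅x⁆∪p x∉S)) (∣p∣≤n (⁅ x ⁆ ∪ S))

  ∃-indepVeDominating : ∃ (IsIndepVeDominating G)
  ∃-indepVeDominating with ∃-minimal independent? (λ S → n ∸ ∣ S ∣) (∅ , λ u _ u∈∅ → contradiction u∈∅ ∉⊥)
  ... | S , max = S , proj₁ max , dominating⇒veDominating (maximum-independent⇒dominating max)

  ∃-iveSet : ∃ (IsIveSet G)
  ∃-iveSet = ∃-minimal indepVeDominating? ∣_∣ ∃-indepVeDominating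

  sole-neighbours-cover : {u v : Fin n} → Connected G → SoleNeighbour v u → IsLeaf G u →
    ∀ w → w ≡ u ⊎ w ≡ v
  sole-neighbours-cover {u} {v} connected (v~u , v-sole) (_ , _ , u-sole) w =
    reach (connected u w) (inj₁ refl)
    where
    u-sole′ : ∀ z → Adj u z → z ≡ v
    u-sole′ z u~z = trans (u-sole z u~z) (sym (u-sole v (adj-sym v~u)))
    reach : ∀ {x y} → Walk G x y → x ≡ u ⊎ x ≡ v → y ≡ u ⊎ y ≡ v
    reach here                 x∈uv        = x∈uv
    reach (step {w = z} x~z p) (inj₁ refl) = reach p (inj₂ (u-sole′ z x~z))
    reach (step {w = z} x~z p) (inj₂ refl) = reach p (inj₁ (v-sole z x~z))

  support-not-leaf : {u v : Fin n} → 3 ≤ n → Connected G → SoleNeighbour v u → ¬ IsLeaf G u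
  support-not-leaf {u} {v} 3≤n connected sole u-leaf
    with ∃-avoiding₂ 3≤n u v
  ... | w , w≢u , w≢v with sole-neighbours-cover connected sole u-leaf w
  ... | inj₁ w≡u = w≢u w≡u
  ... | inj₂ w≡v = w≢v w≡v

  sole-neighbour-ve-dominated : {u v x y : Fin n} → SoleNeighbour v u → Adj x y →
    VeDominatesEdge G v x y → x ≡ u ⊎ y ≡ u
  sole-neighbour-ve-dominated (_ , sole) x~y (inj₁ (inj₁ refl)) = inj₂ (sole _ x~y)
  sole-neighbour-ve-dominated (_ , sole) x~y (inj₁ (inj₂ v~x))  = inj₁ (sole _ v~x)
  sole-neighbour-ve-dominated (_ , sole) x~y (inj₂ (inj₁ refl)) = inj₁ (sole _ (adj-sym x~y))
  sole-neighbour-ve-dominated (_ , sole) x~y (inj₂ (inj₂ v~y))  = inj₂ (sole _ v~y)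

  ve-dominates-edges-at : {u w x y : Fin n} → InClosedNbhd G w u → x ≡ u ⊎ y ≡ u →
    VeDominatesEdge G w x y
  ve-dominates-edges-at u∈N[w] (inj₁ refl) = inj₁ u∈N[w]
  ve-dominates-edges-at u∈N[w] (inj₂ refl) = inj₂ u∈N[w]

  veDominating-exchange : {S S′ : Subset n} {u v w : Fin n} → IsVeDominating G S →
    SoleNeighbour v u → S - v ⊆ S′ → w ∈ S′ → InClosedNbhd G w u → IsVeDominating G S′
  veDominating-exchange {v = v} {w} vd sole S-v⊆S′ w∈S′ u∈N[w] x y x~y with vd x y x~y
  ... | s , s∈S , dom with s ≟ v
  ... | yes refl = w , w∈S′ , ve-dominates-edges-at u∈N[w] (sole-neighbour-ve-dominated sole x~y dom)
  ... | no s≢v   = s , S-v⊆S′ (x∈p∧x≢y⇒x∈p-y s∈S s≢v) , dom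

  leaf-exchange : {S : Subset n} {u v : Fin n} → IsIndepVeDominating G S → v ∈ S → SoleNeighbour v u →
    ∃ λ S′ → IsIndepVeDominating G S′ × ∣ S′ ∣ ≤ ∣ S ∣ × S′ ⊆ ⁅ u ⁆ ∪ (S - v)
  leaf-exchange {S} {u} {v} (ind , vd) v∈S sole with any? (λ w → (w ∈? (S - v)) ×-dec adj? u w)
  ... | yes (w , w∈S-v , u~w) =
    S - v , (independent-⊆ (p─q⊆p S ⁅ v ⁆) ind , vd′) , <⇒≤ (x∈p⇒∣p-x∣<∣p∣ v∈S) , q⊆p∪q ⁅ u ⁆ (S - v)
    where
    vd′ : IsVeDominating G (S - v)
    vd′ = veDominating-exchange vd sole (λ z∈ → z∈) w∈S-v (inj₂ (adj-sym u~w))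
  ... | no u≁S-v =
    ⁅ u ⁆ ∪ (S - v) , (ind′ , vd′) , y∈p⇒∣⁅x⁆∪p-y∣≤∣p∣ u v∈S , (λ z∈ → z∈)
    where
    ind′ : IsIndependent G (⁅ u ⁆ ∪ (S - v))
    ind′ = independent-insert (independent-⊆ (p─q⊆p S ⁅ v ⁆) ind) λ w w∈ u~w → u≁S-v (w , w∈ , u~w)
    vd′ : IsVeDominating G (⁅ u ⁆ ∪ (S - v))
    vd′ = veDominating-exchange vd sole (q⊆p∪q ⁅ u ⁆ (S - v)) (x∈p∪q⁺ (inj₁ (x∈⁅x⁆ u))) (inj₁ refl)

lemma4 : (n : ℕ) → 3 ≤ n → (T : Graph n) → IsTree T →
    ∃ λ S → IsIveSet T S × (∀ v → IsLeaf T v → v ∉ S)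
lemma4 n 3≤n T (connected , _)
  with ∃-minimal (iveSet? T) (λ S → ∣ S ∩ leaves T ∣) (∃-iveSet T)
... | S , iveS , fewest-leaves = S , iveS , no-leaf
  where
  no-leaf : ∀ v → IsLeaf T v → v ∉ S
  no-leaf v (u , sole) v∈S with leaf-exchange T (proj₁ iveS) v∈S sole
  ... | S′ , ivdS′ , ∣S′∣≤∣S∣ , S′⊆ = <⇒≱ fewer (fewest-leaves S′ iveS′)
    where
    iveS′ : IsIveSet T S′
    iveS′ = Minimal-≤ {P = IsIndepVeDominating T} {f = ∣_∣} iveS ivdS′ ∣S′∣≤∣S∣
    u∉leaves : u ∉ leaves T
    u∉leaves u∈ = support-not-leaf T 3≤n connected sole (∈-satisfying⁻ (leaf? T) u∈)
    fewer : ∣ S′ ∩ leaves T ∣ < ∣ S ∩ leaves T ∣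
    fewer = p⊂q⇒∣p∣<∣q∣ (exchange⇒∩⊂ S′⊆ u∉leaves v∈S (∈-satisfying⁺ (leaf? T) (u , sole)))
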